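{- For all integers $b\geqslant 2$, we have $\ell(b)\leqslant (b-1)b$.
   Context: For an integer $b\geqslant 2$ and a set $S\subseteq \{0,1,\dots,b-1\}$, the Kempner set $\mathcal{K}(S,b)$ is the set of non-negative integers whose base-$b$ expansions use only digits from $S$. It is called proper if $0\in S$ and $S\neq\{0,1,\dots,b-1\}$. $\ell(b)$ denotes the length (number of terms) of the longest arithmetic progression (with nonzero common difference) contained in some proper Kempner set of base $b$. -}

module Defs where

open import Data.Nat using (ℕ; zero; suc; _+_; _*_; _<_; _≤_)
open import Data.Fin using (Fin; toℕ)
open import Data.Fin.Subset using (Subset; _∈_; _∉_; ⊤)
open import Data.Product using (Σ; ∃; _×_)
open import Relation.Binary.PropositionalEquality using (_≡_)
open import Relation.Nullary using (¬_)

-- Kempner set K(S,b): natural numbers whose base-b digits all lie in S.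
-- Built digit by digit: n = d + b * m with d the last digit (d ∈ S).
data Kempner {b : ℕ} (S : Subset b) : ℕ → Set where
  kempner-zero  : Kempner S 0
  kempner-digit : (d : Fin b) → d ∈ S → (m : ℕ) → Kempner S m →
                  Kempner S (toℕ d + b * m)

Proper : {b : ℕ} → Subset b → Set
Proper {b} S = (∃ λ (z : Fin b) → toℕ z ≡ 0 × z ∈ S) × ∃ λ (d : Fin b) → d ∉ S

APIn : {b : ℕ} → Subset b → ℕ → ℕ → ℕ → Set
APIn S L a r = 1 ≤ r × ((i : ℕ) → i < L → Kempner S (a + i * r))

-- Let d ∉ S be a missing digit and choose n with r ≤ bⁿ ≤ b r. The numbers whose digit at
-- position n is d form blocks of bⁿ consecutive integers, repeating with period b·bⁿ, so from
-- any start a some block begins within (b - 1) bⁿ ≤ (b - 1) b r. An AP of difference r ≤ bⁿ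
-- cannot jump over a block, so one of its first (b - 1) b + 1 terms falls into it and
-- leaves the Kempner set.
module Submission where

open import Defs
open import Data.Nat using (s≤s⁻¹; ℕ; zero; suc; _+_; _*_; _∸_; _^_; _≤_; _<_; z≤n; s≤s; NonZero; _≤?_; >-nonZero)
open import Data.Nat.Properties
open import Data.Nat.DivMod using (_/_; _%_; m≡m%n+[m/n]*n; m%n<n; [m+kn]%n≡m%n; m<n⇒m%n≡m; m<n*o⇒m/o<n)
open import Data.Nat.Tactic.RingSolver using (solve-∀)
open import Data.Fin using (Fin; toℕ)
open import Data.Fin.Properties using (toℕ<n; toℕ-injective)
open import Data.Fin.Subset using (Subset; _∈_; _∉_)
open import Data.Product using (∃; ∃₂; _×_; _,_; proj₂)
open import Relation.Binary.PropositionalEquality using (_≡_; refl; sym; trans; cong; subst; module ≡-Reasoning)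
open import Relation.Nullary using (¬_; yes; no; contradiction)

digit-split-injective : ∀ b .{{_ : NonZero b}} {t t′ m m′ : ℕ} → t < b → t′ < b →
                        t + b * m ≡ t′ + b * m′ → t ≡ t′ × m ≡ m′
digit-split-injective b {t} {t′} {m} {m′} t<b t′<b eq =
  t≡t′ , *-cancelˡ-≡ m m′ b (+-cancelˡ-≡ t _ _ (trans eq (cong (_+ b * m′) (sym t≡t′))))
  where
  remainder : ∀ {u} k → u < b → (u + b * k) % b ≡ u
  remainder {u} k u<b = trans (cong (λ v → (u + v) % b) (*-comm b k))
                              (trans ([m+kn]%n≡m%n u k b) (m<n⇒m%n≡m u<b))
  t≡t′ : t ≡ t′
  t≡t′ = trans (sym (remainder m t<b)) (trans (cong (_% b) eq) (remainder m′ t′<b))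

module KempnerDigits {b : ℕ} .{{_ : NonZero b}} (S : Subset b)
                     (z : Fin b) (z≡0 : toℕ z ≡ 0) (z∈S : z ∈ S) where

  kempner-view : ∀ {x} → Kempner S x →
                 ∃₂ λ t m → t ∈ S × Kempner S m × x ≡ toℕ t + b * m
  kempner-view kempner-zero = z , 0 , z∈S , kempner-zero , sym (trans (cong (_+ b * 0) z≡0) (*-zeroʳ b))
  kempner-view (kempner-digit t t∈S m km) = t , m , t∈S , km , refl

  kempner-split : ∀ {t m} → t < b → Kempner S (t + b * m) →
                  (∃ λ u → u ∈ S × toℕ u ≡ t) × Kempner S m
  kempner-split t<b k with kempner-view k
  ... | u , m′ , u∈S , km′ , eq with digit-split-injective b t<b (toℕ<n u) eq
  ...   | t≡u , m≡m′ = (u , u∈S , sym t≡u) , subst (Kempner S) (sym m≡m′) km′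

  kempner-shift : ∀ n {y m} → y < b ^ n → Kempner S (y + b ^ n * m) → Kempner S m
  kempner-shift zero {y} {m} y<1 k
    rewrite n<1⇒n≡0 y<1 = subst (Kempner S) (*-identityˡ m) k
  kempner-shift (suc n) {y} {m} y<b^[1+n] k =
    kempner-shift n y/b<b^n (proj₂ (kempner-split (m%n<n y b) (subst (Kempner S) regroup k)))
    where
    y/b<b^n : y / b < b ^ n
    y/b<b^n = m<n*o⇒m/o<n (subst (y <_) (*-comm b (b ^ n)) y<b^[1+n])
    regroup : y + b ^ suc n * m ≡ y % b + b * (y / b + b ^ n * m)
    regroup = begin
      y + b * b ^ n * m                      ≡⟨ cong (_+ b * b ^ n * m) (m≡m%n+[m/n]*n y b) ⟩
      y % b + y / b * b + b * b ^ n * m      ≡⟨ regroup-digits (y % b) (y / b) b (b ^ n) m ⟩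
      y % b + b * (y / b + b ^ n * m)        ∎
      where
      open ≡-Reasoning
      regroup-digits : ∀ r q c p m → r + q * c + c * p * m ≡ r + c * (q + p * m)
      regroup-digits = solve-∀

  kempner-digit-∉ : ∀ {d} → d ∉ S → ∀ n {y q} → y < b ^ n →
                    ¬ Kempner S (y + b ^ n * (toℕ d + b * q))
  kempner-digit-∉ {d} d∉S n y<b^n k
    with kempner-split (toℕ<n d) (kempner-shift n y<b^n k)
  ... | (u , u∈S , u≡d) , _ = d∉S (subst (_∈ S) (toℕ-injective u≡d) u∈S)

  kempner-block-∉ : ∀ {d} → d ∉ S → ∀ n q {x} →
                    toℕ d * b ^ n + q * (b * b ^ n) ≤ x → x < toℕ d * b ^ n + q * (b * b ^ n) + b ^ n →
                    ¬ Kempner S x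
  kempner-block-∉ {d} d∉S n q {x} T≤x x<T+B kx =
    kempner-digit-∉ d∉S n y<B (subst (Kempner S) x≡digits kx)
    where
    T = toℕ d * b ^ n + q * (b * b ^ n)
    y<B : x ∸ T < b ^ n
    y<B = +-cancelˡ-< T _ _ (subst (_< T + b ^ n) (sym (m+[n∸m]≡n T≤x)) x<T+B)
    rearrange : ∀ D q c B y → D * B + q * (c * B) + y ≡ y + B * (D + c * q)
    rearrange = solve-∀
    x≡digits : x ≡ x ∸ T + b ^ n * (toℕ d + b * q)
    x≡digits = trans (sym (m+[n∸m]≡n T≤x)) (rearrange (toℕ d) q b (b ^ n) (x ∸ T))

block-within-gap : ∀ B G o a .{{_ : NonZero (B + G)}} → o ≤ G →
                   ∃ λ k → o + k * (B + G) ≤ a + G × a < o + k * (B + G) + B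
block-within-gap B G o a o≤G with o + B ≤? a % (B + G)
... | no a%P<o+B = a / P , before , inside
  where
  P = B + G
  open ≤-Reasoning
  before : o + a / P * P ≤ a + G
  before = begin
    o + a / P * P      ≤⟨ +-monoˡ-≤ (a / P * P) o≤G ⟩
    G + a / P * P      ≤⟨ +-monoʳ-≤ G (m≤n+m (a / P * P) (a % P)) ⟩
    G + (a % P + a / P * P) ≡⟨ cong (G +_) (sym (m≡m%n+[m/n]*n a P)) ⟩
    G + a              ≡⟨ +-comm G a ⟩
    a + G              ∎
  inside : a < o + a / P * P + B
  inside = begin-strict
    a                  ≡⟨ m≡m%n+[m/n]*n a P ⟩
    a % P + a / P * P  <⟨ +-monoˡ-< (a / P * P) (≰⇒> a%P<o+B) ⟩
    o + B + a / P * P  ≡⟨ +-assoc o B _ ⟩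
    o + (B + a / P * P) ≡⟨ cong (o +_) (+-comm B _) ⟩
    o + (a / P * P + B) ≡⟨ sym (+-assoc o _ B) ⟩
    o + a / P * P + B  ∎
... | yes o+B≤a%P = suc (a / P) , before , inside
  where
  P = B + G
  open ≤-Reasoning
  before : o + suc (a / P) * P ≤ a + G
  before = begin
    o + (P + a / P * P)     ≡⟨ sym (+-assoc o P _) ⟩
    o + (B + G) + a / P * P ≡⟨ cong (_+ a / P * P) (sym (+-assoc o B G)) ⟩
    o + B + G + a / P * P   ≤⟨ +-monoˡ-≤ (a / P * P) (+-monoˡ-≤ G o+B≤a%P) ⟩
    a % P + G + a / P * P   ≡⟨ +-assoc (a % P) G _ ⟩
    a % P + (G + a / P * P) ≡⟨ cong (a % P +_) (+-comm G _) ⟩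
    a % P + (a / P * P + G) ≡⟨ sym (+-assoc (a % P) _ G) ⟩
    a % P + a / P * P + G   ≡⟨ cong (_+ G) (sym (m≡m%n+[m/n]*n a P)) ⟩
    a + G                   ∎
  inside : a < o + suc (a / P) * P + B
  inside = begin-strict
    a                       ≡⟨ m≡m%n+[m/n]*n a P ⟩
    a % P + a / P * P       <⟨ +-monoˡ-< (a / P * P) (m%n<n a P) ⟩
    P + a / P * P           ≤⟨ m≤n+m _ o ⟩
    o + (P + a / P * P)     ≤⟨ m≤m+n _ B ⟩
    o + suc (a / P) * P + B ∎

ap-crosses : ∀ {r} → 1 ≤ r → ∀ g a T → T ≤ a + g → a < T →
             ∃ λ i → T ≤ a + i * r × a + i * r < T + r
ap-crosses r≥1 zero a T T≤a+0 a<T = contradiction (subst (T ≤_) (+-identityʳ a) T≤a+0) (<⇒≱ a<T)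
ap-crosses {r} r≥1 (suc g) a T T≤a+1+g a<T with T ≤? a + r
... | yes T≤a+r = 1 , subst (T ≤_) a+r≡a+1*r T≤a+r , subst (_< T + r) a+r≡a+1*r (+-monoˡ-< r a<T)
  where
  a+r≡a+1*r : a + r ≡ a + 1 * r
  a+r≡a+1*r = cong (a +_) (sym (*-identityˡ r))
... | no T≰a+r with ap-crosses r≥1 g (a + r) T T≤a+r+g (≰⇒> T≰a+r)
  where
  T≤a+r+g : T ≤ a + r + g
  T≤a+r+g = ≤-trans T≤a+1+g (subst (a + suc g ≤_) (sym (+-assoc a r g)) (+-monoʳ-≤ a (+-monoˡ-≤ g r≥1)))
...   | i , T≤ , <T+r = suc i , subst (T ≤_) (+-assoc a r (i * r)) T≤ , subst (_< T + r) (+-assoc a r (i * r)) <T+r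

ap-enters : ∀ {r B T a} g → 1 ≤ r → r ≤ B → T ≤ a + g → a < T + B →
            ∃ λ i → T ≤ a + i * r × a + i * r < T + B × i * r < g + r
ap-enters {r} {B} {T} {a} g r≥1 r≤B T≤a+g a<T+B with T ≤? a
... | yes T≤a = 0 , subst (T ≤_) (sym (+-identityʳ a)) T≤a , subst (_< T + B) (sym (+-identityʳ a)) a<T+B
                  , <-≤-trans r≥1 (m≤n+m r g)
... | no T≰a with ap-crosses r≥1 g a T T≤a+g (≰⇒> T≰a)
...   | i , T≤ , <T+r = i , T≤ , <-≤-trans <T+r (+-monoʳ-≤ T r≤B) , +-cancelˡ-< a _ _ a+ir<a+[g+r]
  where
  a+ir<a+[g+r] : a + i * r < a + (g + r)
  a+ir<a+[g+r] = <-≤-trans <T+r (subst (T + r ≤_) (+-assoc a g r) (+-monoˡ-≤ r T≤a+g))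

n<m^n : ∀ {m} → 1 < m → ∀ n → n < m ^ n
n<m^n 1<m zero = s≤s z≤n
n<m^n {m} 1<m (suc n) = begin-strict
  suc n             ≤⟨ n<m^n 1<m n ⟩
  m ^ n             <⟨ m<m+n (m ^ n) (≤-trans (s≤s z≤n) (n<m^n 1<m n)) ⟩
  m ^ n + m ^ n     ≡⟨ cong (m ^ n +_) (sym (+-identityʳ (m ^ n))) ⟩
  2 * m ^ n         ≤⟨ *-monoˡ-≤ (m ^ n) 1<m ⟩
  m * m ^ n         ∎
  where open ≤-Reasoning

power-between : ∀ {m r} → 1 < m → 1 ≤ r → ∃ λ n → r ≤ m ^ n × m ^ n ≤ m * r
power-between {m} {r} 1<m r≥1 = search r (<⇒≤ (n<m^n 1<m r))
  where
  search : ∀ j → r ≤ m ^ j → ∃ λ n → r ≤ m ^ n × m ^ n ≤ m * r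
  search zero r≤1 = 0 , r≤1 , ≤-trans (<⇒≤ 1<m) (m≤m*n m r {{>-nonZero r≥1}})
  search (suc j) r≤m^[1+j] with r ≤? m ^ j
  ... | yes r≤m^j = search j r≤m^j
  ... | no r≰m^j = suc j , r≤m^[1+j] , *-monoʳ-≤ m (<⇒≤ (≰⇒> r≰m^j))

steps-bound : ∀ {i r c B m} → B ≤ m * r → i * r < c * B + r → i ≤ c * m
steps-bound {i} {r} {c} {B} {m} B≤mr ir<cB+r = s≤s⁻¹ (*-cancelʳ-< r i (suc (c * m)) (begin-strict
  i * r             <⟨ ir<cB+r ⟩
  c * B + r         ≤⟨ +-monoˡ-≤ r (*-monoʳ-≤ c B≤mr) ⟩
  c * (m * r) + r   ≡⟨ cong (_+ r) (sym (*-assoc c m r)) ⟩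
  c * m * r + r     ≡⟨ +-comm (c * m * r) r ⟩
  suc (c * m) * r   ∎))
  where open ≤-Reasoning

ap-leaves-kempner : ∀ {k} (S : Subset (suc (suc k))) → Proper S → ∀ a {r} → 1 ≤ r →
                    ∃ λ i → i ≤ suc k * suc (suc k) × ¬ Kempner S (a + i * r)
ap-leaves-kempner {k} S ((z , z≡0 , z∈S) , (d , d∉S)) a {r} r≥1 =
  let n , r≤B , B≤br = power-between {b} (s≤s (s≤s z≤n)) r≥1
      B = b ^ n
      q , T≤a+G , a<T+B = block-within-gap B (suc k * B) (toℕ d * B) a {{m*n≢0 b B {{_}} {{m^n≢0 b n}}}}
                                           (*-monoˡ-≤ B (s≤s⁻¹ (toℕ<n d)))
      i , T≤x , x<T+B , ir<G+r = ap-enters (suc k * B) r≥1 r≤B T≤a+G a<T+B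
  in i , steps-bound {c = suc k} {m = b} B≤br ir<G+r , kempner-block-∉ d∉S n q T≤x x<T+B
  where
  open KempnerDigits S z z≡0 z∈S
  b = suc (suc k)

proposition2p1 : (b : ℕ) → 2 ≤ b → (S : Subset b) → Proper S →
    (L a r : ℕ) → APIn S L a r → L ≤ (b ∸ 1) * b
proposition2p1 (suc (suc k)) (s≤s (s≤s z≤n)) S proper L a r (r≥1 , ap) =
  let i , i≤ , i∉K = ap-leaves-kempner S proper a r≥1
  in ≮⇒≥ λ L>bound → i∉K (ap i (≤-<-trans i≤ L>bound))
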